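{- Let $G$ be a simple connected graph on $[n]$ such that its Laplacian simplex $\mathcal{P}_G$ is reflexive, and let $L(n)$ be its Laplacian matrix with the $n$-th column deleted. Then \[ \Lambda(\mathcal{P}_G)=\left\{\frac{\mathbf{x}}{n}\;\middle|\;\mathbf{x}\in\mathbb{Z}^n,\ 0\le x_i<n \text{ for all } i,\ \mathbf{x}\cdot[L(n)\mid\mathbb{1}]\equiv\mathbf{0}\bmod n\right\}. \]
   Context: The Laplacian matrix $L$ of a simple graph on $[n]$ has $L_{ii}=\deg(i)$, $L_{ij}=-1$ if $\{i,j\}$ is an edge and $0$ otherwise. The Laplacian simplex $\mathcal{P}_G\subset\mathbb{R}^{n-1}$ is the convex hull of the rows of $L(n)$, ordered as vertices $\mathbf{v}_1,\dots,\mathbf{v}_n$. A lattice polytope is reflexive if it contains the origin in its interior and its dual $\{\mathbf{x}\mid \mathbf{x}\mathbf{y}^T\le 1\ \forall\mathbf{y}\in\mathcal{P}\}$ is a lattice polytope. $[L(n)\mid\mathbb{1}]$ is $L(n)$ with a column of ones appended. For a lattice simplex with ordered vertices $\mathbf{v}_1,\dots,\mathbf{v}_{d+1}$, $\Lambda(\mathcal{P})$ is the set of $\lambda\in[0,1)^{d+1}$ with $\sum_i\lambda_i(\mathbf{v}_i,1)\in\mathbb{Z}^{d+1}$.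
   Formalization: The elements λ of $\Lambda(\mathcal{P}_G)$ range only over rational vectors, and the interior of $\mathcal{P}_G$ and its dual are tested on points of ℚ^(n-1) instead of ℝ^(n-1). -}

module Defs where

open import Data.Nat as ℕ using (ℕ; zero; suc)
open import Data.Fin using (Fin; zero; suc; inject₁; _≟_)
open import Data.Bool using (Bool; true; false)
open import Data.Integer as ℤ using (ℤ)
open import Data.Rational as ℚ using (ℚ; 0ℚ; 1ℚ)
open import Data.Product using (Σ; ∃; _×_; _,_)
open import Data.Sum using (_⊎_)
open import Relation.Binary.PropositionalEquality using (_≡_)
open import Relation.Nullary using (yes; no)

record SimpleGraph (n : ℕ) : Set where
  field
    adj    : Fin n → Fin n → Bool
    sym    : ∀ i j → adj i j ≡ adj j i
    irrefl : ∀ i → adj i i ≡ false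
open SimpleGraph public

data Walk {n : ℕ} (G : SimpleGraph n) : Fin n → Fin n → Set where
  nil  : ∀ {i} → Walk G i i
  cons : ∀ {i j k} → adj G i j ≡ true → Walk G j k → Walk G i k

Connected : ∀ {n} → SimpleGraph n → Set
Connected {n} G = ∀ (i j : Fin n) → Walk G i j

sumℤ : ∀ {k} → (Fin k → ℤ) → ℤ
sumℤ {zero}  f = ℤ.+ 0
sumℤ {suc k} f = f zero ℤ.+ sumℤ (λ i → f (suc i))

sumℚ : ∀ {k} → (Fin k → ℚ) → ℚ
sumℚ {zero}  f = 0ℚ
sumℚ {suc k} f = f zero ℚ.+ sumℚ (λ i → f (suc i))

appendLast : ∀ {A : Set} {k} → (Fin k → A) → A → Fin (suc k) → A
appendLast {k = zero}  f a zero    = a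
appendLast {k = suc k} f a zero    = f zero
appendLast {k = suc k} f a (suc j) = appendLast (λ i → f (suc i)) a j

toℚ : ℤ → ℚ
toℚ z = z ℚ./ 1

IsInt : ℚ → Set
IsInt q = Σ ℤ λ z → q ≡ toℚ z

b2ℤ : Bool → ℤ
b2ℤ true  = ℤ.+ 1
b2ℤ false = ℤ.+ 0

degree : ∀ {n} → SimpleGraph n → Fin n → ℤ
degree G i = sumℤ (λ j → b2ℤ (adj G i j))

laplacian : ∀ {n} → SimpleGraph n → Fin n → Fin n → ℤ
laplacian G i j with i ≟ j
... | yes _ = degree G i
... | no  _ = ℤ.- b2ℤ (adj G i j)

laplacianDel : ∀ {m} → SimpleGraph (suc m) → Fin (suc m) → Fin m → ℤ
laplacianDel G i j = laplacian G i (inject₁ j)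

laplacianAug : ∀ {m} → SimpleGraph (suc m) → Fin (suc m) → Fin (suc m) → ℤ
laplacianAug G i = appendLast (laplacianDel G i) (ℤ.+ 1)

-- Polytopes in ℚ^d (all polytopes here have rational vertices, so we
-- work with their rational points).

Point : ℕ → Set
Point d = Fin d → ℚ

dot : ∀ {d} → Point d → Point d → ℚ
dot x y = sumℚ (λ i → x i ℚ.* y i)

InConvHull : ∀ {d k} → (Fin k → Point d) → Point d → Set
InConvHull {d} {k} v y =
  Σ (Fin k → ℚ) λ λ' →
    (∀ i → 0ℚ ℚ.≤ λ' i) × (sumℚ λ' ≡ 1ℚ) ×
    (∀ c → y c ≡ sumℚ (λ i → λ' i ℚ.* v i c))

OriginInInterior : ∀ {d k} → (Fin k → Point d) → Set
OriginInInterior {d} v =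
  Σ ℚ λ ε → (0ℚ ℚ.< ε) ×
    (∀ (x : Point d) → (∀ c → ℚ.∣ x c ∣ ℚ.≤ ε) → InConvHull v x)

InDual : ∀ {d k} → (Fin k → Point d) → Point d → Set
InDual {d} v x = ∀ (y : Point d) → InConvHull v y → dot x y ℚ.≤ 1ℚ

DualIsLattice : ∀ {d k} → (Fin k → Point d) → Set
DualIsLattice {d} v =
  Σ ℕ λ l → Σ (Fin l → Fin d → ℤ) λ w →
    ∀ (x : Point d) →
      (InDual v x → InConvHull (λ j c → toℚ (w j c)) x) ×
      (InConvHull (λ j c → toℚ (w j c)) x → InDual v x)

Reflexive : ∀ {d k} → (Fin k → Point d) → Set
Reflexive v = OriginInInterior v × DualIsLattice v

-- Laplacian simplex P_G ⊆ ℚ^(n-1): vertices are the rows of L(n)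

lapVertices : ∀ {m} → SimpleGraph (suc m) → Fin (suc m) → Point m
lapVertices G i c = toℚ (laplacianDel G i c)

InLambda : ∀ {d} → (Fin (suc d) → Point d) → Point (suc d) → Set
InLambda {d} v λ' =
  (∀ i → (0ℚ ℚ.≤ λ' i) × (λ' i ℚ.< 1ℚ)) ×
  (∀ c → IsInt (sumℚ (λ i → λ' i ℚ.* appendLast (v i) 1ℚ c)))

InRHS : ∀ {m} → SimpleGraph (suc m) → Point (suc m) → Set
InRHS {m} G λ' =
  Σ (Fin (suc m) → ℤ) λ x →
    (∀ i → (ℤ.+ 0 ℤ.≤ x i) × (x i ℤ.< ℤ.+ suc m)) ×
    (∀ j → ℤ.+ suc m ∣ sumℤ (λ i → x i ℤ.* laplacianAug G i j)) ×
    (∀ i → λ' i ≡ x i ℚ./ suc m)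
  where open import Data.Integer.Divisibility using (_∣_)

-- The right-hand side is the set of λ ∈ [0,1)^n with nλ integral and Σ λ_i (v_i, 1)
-- integral, so it suffices to show nλ ∈ ℤ^n for λ ∈ Λ(P_G). As L is symmetric with zero row sums, the
-- vertices v_i sum to 0, and since they span (the origin is interior) the system ⟨x, v_i⟩ = b_i is
-- solvable whenever Σ b_i = 0. The solution for b = 1 - n e_j lies in the dual polytope, so it is a
-- convex combination of integral dual vertices w. Each w pairs with v_j to at least 1 - n, because the
-- slacks 1 - ⟨w, v_i⟩ are nonnegative and sum to n; hence some integral w has ⟨w, v_i⟩ = 1 - n δ_ij.
-- Pairing it with the integral point Σ λ_i v_i gives Σ λ_i - n λ_j ∈ ℤ.

module Submission where

open import Defs hiding (sym)
open import Data.Nat using (ℕ; suc)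
open import Data.Product using (_×_)

open import Algebra.Bundles using (CommutativeRing)
open import Data.Fin using (Fin; zero; suc; inject₁; fromℕ; _≟_)
open import Data.Fin.Relation.Unary.Top using (view; ‵fromℕ; ‵inject₁)
open import Data.Integer as ℤ using (ℤ)
import Data.Integer.Properties as ℤ
open import Data.Integer.Divisibility using () renaming (_∣_ to _∣ᵤ_)
open import Data.Integer.Divisibility.Signed using (divides; ∣ᵤ⇒∣; ∣⇒∣ᵤ)
open import Data.Nat as ℕ using (zero)
import Data.Nat.Coprimality as Coprimality
open import Data.Product using (Σ; _,_; proj₁; proj₂)
open import Data.Rational
  using (ℚ; mkℚ; ↥_; 0ℚ; 1ℚ; _+_; _*_; _-_; -_; 1/_; ∣_∣; _/_; _≤_; _<_; *≤*; *<*; toℚᵘ;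
         NonZero; positive; nonNegative)
open import Data.Rational.Properties hiding (_≟_)
import Data.Rational.Unnormalised as ℚᵘ
import Data.Rational.Unnormalised.Properties as ℚᵘ
open import Function using (_∘_)
open import Relation.Binary.PropositionalEquality
open import Relation.Nullary using (yes; no; contradiction)

open import Algebra.Properties.Semiring.Sum (CommutativeRing.semiring +-*-commutativeRing)
  using ( sum; sum-cong-≗; sum-replicate-zero; sum-init-last
        ; ∑-distrib-+; ∑-comm; *-distribˡ-sum; *-distribʳ-sum)
open import Algebra.Properties.CommutativeSemigroup
  (CommutativeRing.*-commutativeSemigroup +-*-commutativeRing)
  using (x∙yz≈y∙xz; x∙yz≈z∙yx; xy∙z≈xz∙y)
open import Algebra.Properties.Group +-0-group using (x∙y⁻¹≈ε⇒x≈y; inverseʳ-unique; ⁻¹-involutive)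

*-nonneg : ∀ {p q} → 0ℚ ≤ p → 0ℚ ≤ q → 0ℚ ≤ p * q
*-nonneg {p} {q} p≥0 q≥0 =
  nonNegative⁻¹ (p * q) {{nonNeg*nonNeg⇒nonNeg p {{nonNegative p≥0}} q {{nonNegative q≥0}}}}

*-cancelˡ-≡-pos : ∀ r → 0ℚ < r → ∀ {p q} → r * p ≡ r * q → p ≡ q
*-cancelˡ-≡-pos r r>0 rp≡rq = ≤-antisym
  (*-cancelˡ-≤-pos r {{positive r>0}} (≤-reflexive rp≡rq))
  (*-cancelˡ-≤-pos r {{positive r>0}} (≤-reflexive (sym rp≡rq)))

p≤q⇒0≤q-p : ∀ {p q} → p ≤ q → 0ℚ ≤ q - p
p≤q⇒0≤q-p {p} {q} p≤q = subst (_≤ q - p) (+-inverseʳ p) (+-monoˡ-≤ (- p) p≤q)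

p-[p-q]≡q : ∀ p q → p - (p - q) ≡ q
p-[p-q]≡q p q = begin
  p - (p - q)     ≡⟨ cong (p +_) (neg-distrib-+ p (- q)) ⟩
  p + (- p - - q) ≡⟨ cong (λ t → p + (- p + t)) (⁻¹-involutive q) ⟩
  p + (- p + q)   ≡⟨ +-assoc p (- p) q ⟨
  p - p + q       ≡⟨ cong (_+ q) (+-inverseʳ p) ⟩
  0ℚ + q          ≡⟨ +-identityˡ q ⟩
  q               ∎
  where open ≡-Reasoning

-- After rewriting with this normal form, ℚ arithmetic on embedded integers computes.
toℚ≡mkℚ : ∀ z → toℚ z ≡ mkℚ z 0 (Coprimality.sym (Coprimality.1-coprimeTo ℤ.∣ z ∣))
toℚ≡mkℚ z = ↥p/↧p≡p (mkℚ z 0 _)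

toℚ-injective : ∀ {a b} → toℚ a ≡ toℚ b → a ≡ b
toℚ-injective {a} {b} eq = cong ↥_ (trans (sym (toℚ≡mkℚ a)) (trans eq (toℚ≡mkℚ b)))

toℚ-+ : ∀ a b → toℚ (a ℤ.+ b) ≡ toℚ a + toℚ b
toℚ-+ a b rewrite toℚ≡mkℚ a | toℚ≡mkℚ b =
  cong (_/ 1) (sym (cong₂ ℤ._+_ (ℤ.*-identityʳ a) (ℤ.*-identityʳ b)))

toℚ-* : ∀ a b → toℚ (a ℤ.* b) ≡ toℚ a * toℚ b
toℚ-* a b rewrite toℚ≡mkℚ a | toℚ≡mkℚ b = refl

toℚ-neg : ∀ a → toℚ (ℤ.- a) ≡ - toℚ a
toℚ-neg a rewrite toℚ≡mkℚ a | toℚ≡mkℚ (ℤ.- a) with a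
... | ℤ.+ zero    = refl
... | ℤ.+ suc n   = refl
... | ℤ.-[1+ n ] = refl

toℚ-mono-≤ : ∀ {a b} → a ℤ.≤ b → toℚ a ≤ toℚ b
toℚ-mono-≤ {a} {b} a≤b rewrite toℚ≡mkℚ a | toℚ≡mkℚ b =
  *≤* (subst₂ ℤ._≤_ (sym (ℤ.*-identityʳ a)) (sym (ℤ.*-identityʳ b)) a≤b)

toℚ-cancel-≤ : ∀ {a b} → toℚ a ≤ toℚ b → a ℤ.≤ b
toℚ-cancel-≤ {a} {b} le rewrite toℚ≡mkℚ a | toℚ≡mkℚ b with le
... | *≤* a≤b = subst₂ ℤ._≤_ (ℤ.*-identityʳ a) (ℤ.*-identityʳ b) a≤b

toℚ-mono-< : ∀ {a b} → a ℤ.< b → toℚ a < toℚ b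
toℚ-mono-< {a} {b} a<b rewrite toℚ≡mkℚ a | toℚ≡mkℚ b =
  *<* (subst₂ ℤ._<_ (sym (ℤ.*-identityʳ a)) (sym (ℤ.*-identityʳ b)) a<b)

toℚ-cancel-< : ∀ {a b} → toℚ a < toℚ b → a ℤ.< b
toℚ-cancel-< {a} {b} lt rewrite toℚ≡mkℚ a | toℚ≡mkℚ b with lt
... | *<* a<b = subst₂ ℤ._<_ (ℤ.*-identityʳ a) (ℤ.*-identityʳ b) a<b

toℚ-suc>0 : ∀ m → 0ℚ < toℚ (ℤ.+ suc m)
toℚ-suc>0 m = toℚ-mono-< {ℤ.+ 0} {ℤ.+ suc m} (ℤ.+<+ (ℕ.s≤s ℕ.z≤n))

n*[z/n]≡z : ∀ z m → toℚ (ℤ.+ suc m) * (z / suc m) ≡ toℚ z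
n*[z/n]≡z z m = toℚᵘ-injective (begin
  toℚᵘ (n * (z / suc m))
    ≈⟨ toℚᵘ-homo-* n (z / suc m) ⟩
  toℚᵘ n ℚᵘ.* toℚᵘ (z / suc m)
    ≈⟨ ℚᵘ.*-cong (ℚᵘ.≃-reflexive (cong toℚᵘ (toℚ≡mkℚ (ℤ.+ suc m)))) (toℚᵘ-fromℚᵘ (ℚᵘ.mkℚᵘ z m)) ⟩
  ℚᵘ.mkℚᵘ (ℤ.+ suc m) 0 ℚᵘ.* ℚᵘ.mkℚᵘ z m
    ≈⟨ ℚᵘ.*≡* n*z*1≡z*[1*n] ⟩
  ℚᵘ.mkℚᵘ z 0
    ≡⟨ cong toℚᵘ (toℚ≡mkℚ z) ⟨
  toℚᵘ (toℚ z) ∎)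
  where
  open ℚᵘ.≃-Reasoning
  n = toℚ (ℤ.+ suc m)
  n*z*1≡z*[1*n] : ℤ.+ suc m ℤ.* z ℤ.* ℤ.+ 1 ≡ z ℤ.* (ℤ.+ 1 ℤ.* ℤ.+ suc m)
  n*z*1≡z*[1*n] = trans (ℤ.*-identityʳ _)
    (trans (ℤ.*-comm (ℤ.+ suc m) z) (cong (z ℤ.*_) (sym (ℤ.*-identityˡ (ℤ.+ suc m)))))

IsInt-+ : ∀ {p q} → IsInt p → IsInt q → IsInt (p + q)
IsInt-+ (a , refl) (b , refl) = a ℤ.+ b , sym (toℚ-+ a b)

IsInt-neg : ∀ {p} → IsInt p → IsInt (- p)
IsInt-neg (a , refl) = ℤ.- a , sym (toℚ-neg a)

IsInt-* : ∀ {p q} → IsInt p → IsInt q → IsInt (p * q)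
IsInt-* (a , refl) (b , refl) = a ℤ.* b , sym (toℚ-* a b)

IsInt-sumℚ : ∀ {k} (f : Fin k → ℚ) → (∀ i → IsInt (f i)) → IsInt (sumℚ f)
IsInt-sumℚ {zero}  f int = ℤ.+ 0 , refl
IsInt-sumℚ {suc k} f int = IsInt-+ (int zero) (IsInt-sumℚ (f ∘ suc) (int ∘ suc))

sumℚ≡sum : ∀ {k} (f : Fin k → ℚ) → sumℚ f ≡ sum f
sumℚ≡sum {zero}  f = refl
sumℚ≡sum {suc k} f = cong (f zero +_) (sumℚ≡sum (f ∘ suc))

sumℚ-cong : ∀ {k} {f g : Fin k → ℚ} → (∀ i → f i ≡ g i) → sumℚ f ≡ sumℚ g
sumℚ-cong {f = f} {g} f≗g = trans (sumℚ≡sum f) (trans (sum-cong-≗ f≗g) (sym (sumℚ≡sum g)))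

sumℚ-zero : ∀ k → sumℚ {k} (λ _ → 0ℚ) ≡ 0ℚ
sumℚ-zero k = trans (sumℚ≡sum {k} (λ _ → 0ℚ)) (sum-replicate-zero k)

sumℚ-+ : ∀ {k} (f g : Fin k → ℚ) → sumℚ (λ i → f i + g i) ≡ sumℚ f + sumℚ g
sumℚ-+ f g = trans (sumℚ≡sum (λ i → f i + g i))
  (trans (∑-distrib-+ f g) (sym (cong₂ _+_ (sumℚ≡sum f) (sumℚ≡sum g))))

*-distribˡ-sumℚ : ∀ {k} c (f : Fin k → ℚ) → c * sumℚ f ≡ sumℚ (λ i → c * f i)
*-distribˡ-sumℚ c f = trans (cong (c *_) (sumℚ≡sum f))
  (trans (*-distribˡ-sum c f) (sym (sumℚ≡sum (λ i → c * f i))))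

*-distribʳ-sumℚ : ∀ {k} c (f : Fin k → ℚ) → sumℚ f * c ≡ sumℚ (λ i → f i * c)
*-distribʳ-sumℚ c f = trans (cong (_* c) (sumℚ≡sum f))
  (trans (*-distribʳ-sum c f) (sym (sumℚ≡sum (λ i → f i * c))))

sumℚ-comm : ∀ {k l} (f : Fin k → Fin l → ℚ) →
  sumℚ (λ i → sumℚ (f i)) ≡ sumℚ (λ j → sumℚ (λ i → f i j))
sumℚ-comm f = trans (sumℚ²≡sum² f) (trans (∑-comm f) (sym (sumℚ²≡sum² (λ j i → f i j))))
  where
  sumℚ²≡sum² : ∀ {k l} (g : Fin k → Fin l → ℚ) →
    sumℚ (λ i → sumℚ (g i)) ≡ sum (λ i → sum (g i))
  sumℚ²≡sum² g = trans (sumℚ≡sum (λ i → sumℚ (g i))) (sum-cong-≗ (sumℚ≡sum ∘ g))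

sumℚ-init-last : ∀ {m} (f : Fin (suc m) → ℚ) → sumℚ f ≡ sumℚ (f ∘ inject₁) + f (fromℕ m)
sumℚ-init-last f = trans (sumℚ≡sum f)
  (trans (sum-init-last f) (cong (_+ f (fromℕ _)) (sym (sumℚ≡sum (f ∘ inject₁)))))

sumℚ-neg : ∀ {k} (f : Fin k → ℚ) → sumℚ (λ i → - f i) ≡ - sumℚ f
sumℚ-neg {zero}  f = refl
sumℚ-neg {suc k} f =
  trans (cong (- f zero +_) (sumℚ-neg (f ∘ suc))) (sym (neg-distrib-+ (f zero) _))

sumℚ-- : ∀ {k} (f g : Fin k → ℚ) → sumℚ (λ i → f i - g i) ≡ sumℚ f - sumℚ g
sumℚ-- f g = trans (sumℚ-+ f (λ i → - g i)) (cong (sumℚ f +_) (sumℚ-neg g))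

sumℚ-weighted-sub : ∀ {k} (μ : Fin k → ℚ) s (f : Fin k → ℚ) →
  sumℚ (λ r → μ r * (s - f r)) ≡ sumℚ μ * s - sumℚ (λ r → μ r * f r)
sumℚ-weighted-sub μ s f = begin
  sumℚ (λ r → μ r * (s - f r))
    ≡⟨ sumℚ-cong (λ r → μ[s-f]≡μs-μf (μ r) s (f r)) ⟩
  sumℚ (λ r → μ r * s - μ r * f r)
    ≡⟨ sumℚ-- (λ r → μ r * s) (λ r → μ r * f r) ⟩
  sumℚ (λ r → μ r * s) - sumℚ (λ r → μ r * f r)
    ≡⟨ cong (_- sumℚ (λ r → μ r * f r)) (*-distribʳ-sumℚ s μ) ⟨
  sumℚ μ * s - sumℚ (λ r → μ r * f r) ∎
  where
  open ≡-Reasoning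
  μ[s-f]≡μs-μf : ∀ p q r → p * (q - r) ≡ p * q - p * r
  μ[s-f]≡μs-μf p q r = trans (*-distribˡ-+ p q (- r)) (cong (p * q +_) (sym (neg-distribʳ-* p r)))

sumℚ-ones : ∀ k → sumℚ {k} (λ _ → 1ℚ) ≡ toℚ (ℤ.+ k)
sumℚ-ones zero    = refl
sumℚ-ones (suc k) = trans (cong (1ℚ +_) (sumℚ-ones k)) (sym (toℚ-+ (ℤ.+ 1) (ℤ.+ k)))

toℚ-sumℤ : ∀ {k} (f : Fin k → ℤ) → toℚ (sumℤ f) ≡ sumℚ (toℚ ∘ f)
toℚ-sumℤ {zero}  f = refl
toℚ-sumℤ {suc k} f = trans (toℚ-+ (f zero) _) (cong (toℚ (f zero) +_) (toℚ-sumℤ (f ∘ suc)))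

toℚ-sumℤ-scaled : ∀ {k} (s : ℚ) (x u : Fin k → ℤ) (q : Fin k → ℚ) →
  (∀ i → toℚ (x i) ≡ s * q i) →
  toℚ (sumℤ (λ i → x i ℤ.* u i)) ≡ s * sumℚ (λ i → q i * toℚ (u i))
toℚ-sumℤ-scaled s x u q x≡s*q = begin
  toℚ (sumℤ (λ i → x i ℤ.* u i))
    ≡⟨ toℚ-sumℤ (λ i → x i ℤ.* u i) ⟩
  sumℚ (λ i → toℚ (x i ℤ.* u i))
    ≡⟨ sumℚ-cong (λ i → trans (toℚ-* (x i) (u i)) (cong (_* toℚ (u i)) (x≡s*q i))) ⟩
  sumℚ (λ i → s * q i * toℚ (u i))
    ≡⟨ sumℚ-cong (λ i → *-assoc s (q i) (toℚ (u i))) ⟩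
  sumℚ (λ i → s * (q i * toℚ (u i)))
    ≡⟨ *-distribˡ-sumℚ s (λ i → q i * toℚ (u i)) ⟨
  s * sumℚ (λ i → q i * toℚ (u i)) ∎
  where open ≡-Reasoning

sumℚ-mono-≤ : ∀ {k} {f g : Fin k → ℚ} → (∀ i → f i ≤ g i) → sumℚ f ≤ sumℚ g
sumℚ-mono-≤ {zero}  f≤g = ≤-refl
sumℚ-mono-≤ {suc k} f≤g = +-mono-≤ (f≤g zero) (sumℚ-mono-≤ (f≤g ∘ suc))

term≤sumℚ : ∀ {k} (f : Fin k → ℚ) → (∀ i → 0ℚ ≤ f i) → ∀ j → f j ≤ sumℚ f
term≤sumℚ {suc k} f f≥0 zero = begin
  f zero                       ≡⟨ +-identityʳ (f zero) ⟨
  f zero + 0ℚ                  ≡⟨ cong (f zero +_) (sumℚ-zero k) ⟨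
  f zero + sumℚ {k} (λ _ → 0ℚ) ≤⟨ +-monoʳ-≤ (f zero) (sumℚ-mono-≤ (f≥0 ∘ suc)) ⟩
  f zero + sumℚ (f ∘ suc)      ∎
  where open ≤-Reasoning
term≤sumℚ {suc k} f f≥0 (suc j) = begin
  f (suc j)                    ≤⟨ term≤sumℚ (f ∘ suc) (f≥0 ∘ suc) j ⟩
  sumℚ (f ∘ suc)               ≡⟨ +-identityˡ _ ⟨
  0ℚ + sumℚ (f ∘ suc)          ≤⟨ +-monoˡ-≤ (sumℚ (f ∘ suc)) (f≥0 zero) ⟩
  f zero + sumℚ (f ∘ suc)      ∎
  where open ≤-Reasoning

nonneg-sumℚ≡0 : ∀ {k} (f : Fin k → ℚ) →
  (∀ i → 0ℚ ≤ f i) → sumℚ f ≡ 0ℚ → ∀ i → f i ≡ 0ℚ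
nonneg-sumℚ≡0 f f≥0 Σf≡0 i = ≤-antisym (subst (f i ≤_) Σf≡0 (term≤sumℚ f f≥0 i)) (f≥0 i)

sumℚ-pos⇒pos-term : ∀ {k} (f : Fin k → ℚ) → 0ℚ < sumℚ f → Σ (Fin k) λ i → 0ℚ < f i
sumℚ-pos⇒pos-term {zero}  f Σf>0 = contradiction Σf>0 (<-irrefl refl)
sumℚ-pos⇒pos-term {suc k} f Σf>0 with 0ℚ <? f zero
... | yes f₀>0 = zero , f₀>0
... | no  f₀≯0 =
  let i , fi>0 = sumℚ-pos⇒pos-term (f ∘ suc)
                   (<-≤-trans Σf>0 (≤-trans (+-monoˡ-≤ _ (≮⇒≥ f₀≯0))
                                           (≤-reflexive (+-identityˡ _))))
  in suc i , fi>0

δ : ∀ {k} → Fin k → Fin k → ℚ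
δ zero    zero    = 1ℚ
δ zero    (suc _) = 0ℚ
δ (suc _) zero    = 0ℚ
δ (suc i) (suc j) = δ i j

δ-diag : ∀ {k} (i : Fin k) → δ i i ≡ 1ℚ
δ-diag zero    = refl
δ-diag (suc i) = δ-diag i

δ-off : ∀ {k} {i j : Fin k} → i ≢ j → δ i j ≡ 0ℚ
δ-off {i = zero}  {zero}  i≢j = contradiction refl i≢j
δ-off {i = zero}  {suc j} i≢j = refl
δ-off {i = suc i} {zero}  i≢j = refl
δ-off {i = suc i} {suc j} i≢j = δ-off (i≢j ∘ cong suc)

δ-sym : ∀ {k} (i j : Fin k) → δ i j ≡ δ j i
δ-sym zero    zero    = refl
δ-sym zero    (suc j) = refl
δ-sym (suc i) zero    = refl
δ-sym (suc i) (suc j) = δ-sym i j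

δ-nonneg : ∀ {k} (i j : Fin k) → 0ℚ ≤ δ i j
δ-nonneg zero    zero    = nonNegative⁻¹ 1ℚ
δ-nonneg zero    (suc j) = ≤-refl
δ-nonneg (suc i) zero    = ≤-refl
δ-nonneg (suc i) (suc j) = δ-nonneg i j

sumℚ-δ : ∀ {k} (j : Fin k) (f : Fin k → ℚ) → sumℚ (λ i → δ j i * f i) ≡ f j
sumℚ-δ {suc k} zero f = begin
  1ℚ * f zero + sumℚ (λ i → 0ℚ * f (suc i))
    ≡⟨ cong₂ _+_ (*-identityˡ (f zero)) (sumℚ-cong (λ i → *-zeroˡ (f (suc i)))) ⟩
  f zero + sumℚ {k} (λ _ → 0ℚ)
    ≡⟨ cong (f zero +_) (sumℚ-zero k) ⟩
  f zero + 0ℚ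
    ≡⟨ +-identityʳ (f zero) ⟩
  f zero ∎
  where open ≡-Reasoning
sumℚ-δ {suc k} (suc j) f =
  trans (cong₂ _+_ (*-zeroˡ (f zero)) (sumℚ-δ j (f ∘ suc))) (+-identityˡ (f (suc j)))

sumℚ-δʳ : ∀ {k} (j : Fin k) (f : Fin k → ℚ) → sumℚ (λ i → f i * δ i j) ≡ f j
sumℚ-δʳ j f = trans (sumℚ-cong (λ i → trans (*-comm (f i) (δ i j)) (cong (_* f i) (δ-sym i j))))
  (sumℚ-δ j f)

sumℚ-δ-row : ∀ {k} (j : Fin k) → sumℚ (δ j) ≡ 1ℚ
sumℚ-δ-row j = trans (sumℚ-cong (λ i → sym (*-identityʳ (δ j i)))) (sumℚ-δ j (λ _ → 1ℚ))

appendLast-inject₁ : ∀ {A : Set} {m} (f : Fin m → A) a c → appendLast f a (inject₁ c) ≡ f c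
appendLast-inject₁ {m = suc m} f a zero    = refl
appendLast-inject₁ {m = suc m} f a (suc c) = appendLast-inject₁ (f ∘ suc) a c

appendLast-last : ∀ {A : Set} {m} (f : Fin m → A) a → appendLast f a (fromℕ m) ≡ a
appendLast-last {m = zero}  f a = refl
appendLast-last {m = suc m} f a = appendLast-last (f ∘ suc) a

appendLast-map : ∀ {A B : Set} (g : A → B) {m} (f : Fin m → A) a c →
  g (appendLast f a c) ≡ appendLast (g ∘ f) (g a) c
appendLast-map g {zero}  f a zero    = refl
appendLast-map g {suc m} f a zero    = refl
appendLast-map g {suc m} f a (suc c) = appendLast-map g (f ∘ suc) a c

dot-comm : ∀ {d} (x y : Point d) → dot x y ≡ dot y x
dot-comm x y = sumℚ-cong (λ c → *-comm (x c) (y c))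

dot-combinationʳ : ∀ {d k} (x y : Point d) (α : Fin k → ℚ) (u : Fin k → Point d) →
  (∀ c → y c ≡ sumℚ (λ i → α i * u i c)) → dot x y ≡ sumℚ (λ i → α i * dot x (u i))
dot-combinationʳ x y α u y≡Σαu = begin
  sumℚ (λ c → x c * y c)
    ≡⟨ sumℚ-cong (λ c → cong (x c *_) (y≡Σαu c)) ⟩
  sumℚ (λ c → x c * sumℚ (λ i → α i * u i c))
    ≡⟨ sumℚ-cong (λ c → *-distribˡ-sumℚ (x c) (λ i → α i * u i c)) ⟩
  sumℚ (λ c → sumℚ (λ i → x c * (α i * u i c)))
    ≡⟨ sumℚ-comm (λ c i → x c * (α i * u i c)) ⟩
  sumℚ (λ i → sumℚ (λ c → x c * (α i * u i c)))
    ≡⟨ sumℚ-cong (λ i → sumℚ-cong (λ c → x∙yz≈y∙xz (x c) (α i) (u i c))) ⟩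
  sumℚ (λ i → sumℚ (λ c → α i * (x c * u i c)))
    ≡⟨ sumℚ-cong (λ i → *-distribˡ-sumℚ (α i) (λ c → x c * u i c)) ⟨
  sumℚ (λ i → α i * dot x (u i)) ∎
  where open ≡-Reasoning

dot-combinationˡ : ∀ {d k} (x y : Point d) (α : Fin k → ℚ) (u : Fin k → Point d) →
  (∀ c → x c ≡ sumℚ (λ i → α i * u i c)) → dot x y ≡ sumℚ (λ i → α i * dot (u i) y)
dot-combinationˡ x y α u x≡Σαu = trans (dot-comm x y) (trans (dot-combinationʳ y x α u x≡Σαu)
  (sumℚ-cong (λ i → cong (α i *_) (dot-comm y (u i)))))

vertex-in-hull : ∀ {d k} (u : Fin k → Point d) i → InConvHull u (u i)
vertex-in-hull u i = δ i , δ-nonneg i , sumℚ-δ-row i , (λ c → sym (sumℚ-δ i (λ i′ → u i′ c)))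

InDual-if-vertices : ∀ {d k} (v : Fin k → Point d) x → (∀ i → dot x (v i) ≤ 1ℚ) → InDual v x
InDual-if-vertices v x x·v≤1 y (α , α≥0 , Σα≡1 , y≡Σαv) = begin
  dot x y
    ≡⟨ dot-combinationʳ x y α v y≡Σαv ⟩
  sumℚ (λ i → α i * dot x (v i))
    ≤⟨ sumℚ-mono-≤ (λ i → *-monoˡ-≤-nonNeg (α i) {{nonNegative (α≥0 i)}} (x·v≤1 i)) ⟩
  sumℚ (λ i → α i * 1ℚ)
    ≡⟨ sumℚ-cong (λ i → *-identityʳ (α i)) ⟩
  sumℚ α
    ≡⟨ Σα≡1 ⟩
  1ℚ ∎
  where open ≤-Reasoning

InSpan : ∀ {d k} → (Fin k → Point d) → Point d → Set
InSpan {d} {k} v y = Σ (Fin k → ℚ) λ β → ∀ c → y c ≡ sumℚ (λ i → β i * v i c)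

∣δ*ε∣≤ε : ∀ {k} (i j : Fin k) {ε} → 0ℚ ≤ ε → ∣ δ i j * ε ∣ ≤ ε
∣δ*ε∣≤ε zero    zero    {ε} ε≥0 =
  ≤-reflexive (trans (cong ∣_∣ (*-identityˡ ε)) (0≤p⇒∣p∣≡p ε≥0))
∣δ*ε∣≤ε zero    (suc j) {ε} ε≥0 = subst (_≤ ε) (cong ∣_∣ (sym (*-zeroˡ ε))) ε≥0
∣δ*ε∣≤ε (suc i) zero    {ε} ε≥0 = subst (_≤ ε) (cong ∣_∣ (sym (*-zeroˡ ε))) ε≥0
∣δ*ε∣≤ε (suc i) (suc j)     ε≥0 = ∣δ*ε∣≤ε i j ε≥0

interior⇒unit-in-span : ∀ {d k} (v : Fin k → Point d) → OriginInInterior v → ∀ c → InSpan v (δ c)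
interior⇒unit-in-span {k = k} v (ε , ε>0 , box) c = β , δ≡Σβv
  where
  instance
    ε≢0 : NonZero ε
    ε≢0 = pos⇒nonZero ε {{positive ε>0}}
  hull : InConvHull v (λ c′ → δ c c′ * ε)
  hull = box (λ c′ → δ c c′ * ε) (λ c′ → ∣δ*ε∣≤ε c c′ (<⇒≤ ε>0))
  α β : Fin k → ℚ
  α = proj₁ hull
  β i = α i * 1/ ε
  δ≡Σβv : ∀ c′ → δ c c′ ≡ sumℚ (λ i → β i * v i c′)
  δ≡Σβv c′ = begin
    δ c c′                                  ≡⟨ *-identityʳ (δ c c′) ⟨
    δ c c′ * 1ℚ                             ≡⟨ cong (δ c c′ *_) (*-inverseʳ ε) ⟨
    δ c c′ * (ε * 1/ ε)                     ≡⟨ *-assoc (δ c c′) ε (1/ ε) ⟨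
    δ c c′ * ε * 1/ ε                       ≡⟨ cong (_* 1/ ε) (proj₂ (proj₂ (proj₂ hull)) c′) ⟩
    sumℚ (λ i → α i * v i c′) * 1/ ε        ≡⟨ *-distribʳ-sumℚ (1/ ε) (λ i → α i * v i c′) ⟩
    sumℚ (λ i → α i * v i c′ * 1/ ε)        ≡⟨ sumℚ-cong (λ i → xy∙z≈xz∙y (α i) (v i c′) (1/ ε)) ⟩
    sumℚ (λ i → α i * 1/ ε * v i c′)        ∎
    where open ≡-Reasoning

module SymmetricZeroRowSum {m : ℕ} (L : Fin (suc m) → Fin (suc m) → ℚ)
  (L-sym : ∀ i k → L i k ≡ L k i) (L-rowsum : ∀ i → sumℚ (L i) ≡ 0ℚ) where

  rows : Fin (suc m) → Point m
  rows i = L i ∘ inject₁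

  -- Zero row sums allow shifting z so that its last coordinate, the one dropped by L(n), vanishes.
  sum-z*L≡dot-shifted : ∀ (z : Fin (suc m) → ℚ) i →
    sumℚ (λ k → z k * L i k) ≡ dot (λ c → z (inject₁ c) - z (fromℕ m)) (rows i)
  sum-z*L≡dot-shifted z i = begin
    Σz
      ≡⟨ +-identityʳ Σz ⟨
    Σz + 0ℚ
      ≡⟨ cong (Σz +_) (trans (cong (- zₗ *_) (L-rowsum i)) (*-zeroʳ (- zₗ))) ⟨
    Σz + - zₗ * sumℚ (L i)
      ≡⟨ cong (Σz +_) (*-distribˡ-sumℚ (- zₗ) (L i)) ⟩
    Σz + sumℚ (λ k → - zₗ * L i k)
      ≡⟨ sumℚ-+ (λ k → z k * L i k) (λ k → - zₗ * L i k) ⟨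
    sumℚ (λ k → z k * L i k + - zₗ * L i k)
      ≡⟨ sumℚ-cong (λ k → sym (*-distribʳ-+ (L i k) (z k) (- zₗ))) ⟩
    sumℚ (λ k → (z k - zₗ) * L i k)
      ≡⟨ sumℚ-init-last (λ k → (z k - zₗ) * L i k) ⟩
    dot x (rows i) + (zₗ - zₗ) * L i (fromℕ m)
      ≡⟨ cong (dot x (rows i) +_)
           (trans (cong (_* L i (fromℕ m)) (+-inverseʳ zₗ)) (*-zeroˡ (L i (fromℕ m)))) ⟩
    dot x (rows i) + 0ℚ
      ≡⟨ +-identityʳ (dot x (rows i)) ⟩
    dot x (rows i) ∎
    where
    open ≡-Reasoning
    zₗ Σz : ℚ
    zₗ = z (fromℕ m)
    Σz = sumℚ (λ k → z k * L i k)
    x : Point m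
    x c = z (inject₁ c) - zₗ

  module _ (β : Fin m → Fin (suc m) → ℚ)
           (βL≡δ : ∀ c c′ → sumℚ (λ k → β c k * L k (inject₁ c′)) ≡ δ c c′) where

    βL-last : ∀ c → sumℚ (λ k → β c k * L k (fromℕ m)) ≡ - 1ℚ
    βL-last c = inverseʳ-unique 1ℚ (βL (fromℕ m)) (begin
      1ℚ + βL (fromℕ m)
        ≡⟨ cong (_+ βL (fromℕ m))
             (trans (sym (sumℚ-δ-row c)) (sumℚ-cong (λ c′ → sym (βL≡δ c c′)))) ⟩
      sumℚ (βL ∘ inject₁) + βL (fromℕ m)
        ≡⟨ sumℚ-init-last βL ⟨
      sumℚ βL
        ≡⟨ sumℚ-comm (λ i k → β c k * L k i) ⟩
      sumℚ (λ k → sumℚ (λ i → β c k * L k i))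
        ≡⟨ sumℚ-cong (λ k → *-distribˡ-sumℚ (β c k) (L k)) ⟨
      sumℚ (λ k → β c k * sumℚ (L k))
        ≡⟨ sumℚ-cong (λ k → trans (cong (β c k *_) (L-rowsum k)) (*-zeroʳ (β c k))) ⟩
      sumℚ {suc m} (λ _ → 0ℚ)
        ≡⟨ sumℚ-zero (suc m) ⟩
      0ℚ ∎)
      where
      open ≡-Reasoning
      βL : Fin (suc m) → ℚ
      βL i = sumℚ (λ k → β c k * L k i)

    preimage : (Fin (suc m) → ℚ) → Fin (suc m) → ℚ
    preimage b k = sumℚ (λ c → b (inject₁ c) * β c k)

    L-preimage : ∀ b i →
      sumℚ (λ k → preimage b k * L i k)
        ≡ sumℚ (λ c → b (inject₁ c) * sumℚ (λ k → β c k * L k i))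
    L-preimage b i = begin
      sumℚ (λ k → preimage b k * L i k)
        ≡⟨ sumℚ-cong (λ k → *-distribʳ-sumℚ (L i k) (λ c → b (inject₁ c) * β c k)) ⟩
      sumℚ (λ k → sumℚ (λ c → b (inject₁ c) * β c k * L i k))
        ≡⟨ sumℚ-comm (λ k c → b (inject₁ c) * β c k * L i k) ⟩
      sumℚ (λ c → sumℚ (λ k → b (inject₁ c) * β c k * L i k))
        ≡⟨ sumℚ-cong (λ c → sumℚ-cong (λ k → bβL≡bβLᵀ c k)) ⟩
      sumℚ (λ c → sumℚ (λ k → b (inject₁ c) * (β c k * L k i)))
        ≡⟨ sumℚ-cong (λ c → *-distribˡ-sumℚ (b (inject₁ c)) (λ k → β c k * L k i)) ⟨
      sumℚ (λ c → b (inject₁ c) * sumℚ (λ k → β c k * L k i)) ∎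
      where
      open ≡-Reasoning
      bβL≡bβLᵀ : ∀ c k → b (inject₁ c) * β c k * L i k ≡ b (inject₁ c) * (β c k * L k i)
      bβL≡bβLᵀ c k = trans (*-assoc (b (inject₁ c)) (β c k) (L i k))
        (cong (λ t → b (inject₁ c) * (β c k * t)) (L-sym i k))

    preimage-correct : ∀ b → sumℚ b ≡ 0ℚ → ∀ i → sumℚ (λ k → preimage b k * L i k) ≡ b i
    preimage-correct b Σb≡0 i with view i
    ... | ‵inject₁ c′ = begin
      sumℚ (λ k → preimage b k * L (inject₁ c′) k)
        ≡⟨ L-preimage b (inject₁ c′) ⟩
      sumℚ (λ c → b (inject₁ c) * sumℚ (λ k → β c k * L k (inject₁ c′)))
        ≡⟨ sumℚ-cong (λ c → cong (b (inject₁ c) *_) (βL≡δ c c′)) ⟩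
      sumℚ (λ c → b (inject₁ c) * δ c c′)
        ≡⟨ sumℚ-δʳ c′ (b ∘ inject₁) ⟩
      b (inject₁ c′) ∎
      where open ≡-Reasoning
    ... | ‵fromℕ = begin
      sumℚ (λ k → preimage b k * L (fromℕ m) k)
        ≡⟨ L-preimage b (fromℕ m) ⟩
      sumℚ (λ c → b (inject₁ c) * sumℚ (λ k → β c k * L k (fromℕ m)))
        ≡⟨ sumℚ-cong (λ c → cong (b (inject₁ c) *_) (βL-last c)) ⟩
      sumℚ (λ c → b (inject₁ c) * - 1ℚ)
        ≡⟨ sumℚ-cong (λ c → p*-1≡-p (b (inject₁ c))) ⟩
      sumℚ (λ c → - b (inject₁ c))
        ≡⟨ sumℚ-neg (b ∘ inject₁) ⟩
      - sumℚ (b ∘ inject₁)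
        ≡⟨ inverseʳ-unique _ _ (trans (sym (sumℚ-init-last b)) Σb≡0) ⟨
      b (fromℕ m) ∎
      where
      open ≡-Reasoning
      p*-1≡-p : ∀ p → p * - 1ℚ ≡ - p
      p*-1≡-p p = trans (sym (neg-distribʳ-* p 1ℚ)) (cong -_ (*-identityʳ p))

  solvable : (∀ c → InSpan rows (δ c)) →
    ∀ b → sumℚ b ≡ 0ℚ → Σ (Point m) λ x → ∀ i → dot x (rows i) ≡ b i
  solvable span b Σb≡0 =
    (λ c → z (inject₁ c) - z (fromℕ m)) ,
    λ i → trans (sym (sum-z*L≡dot-shifted z i)) (preimage-correct β βL≡δ b Σb≡0 i)
    where
    β : Fin m → Fin (suc m) → ℚ
    β c = proj₁ (span c)
    βL≡δ : ∀ c c′ → sumℚ (λ k → β c k * L k (inject₁ c′)) ≡ δ c c′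
    βL≡δ c c′ = sym (proj₂ (span c) c′)
    z : Fin (suc m) → ℚ
    z = preimage β βL≡δ b

convex-combination≡0⇒zero-term : ∀ {l} (μ t : Fin l → ℚ) →
  (∀ r → 0ℚ ≤ μ r) → sumℚ μ ≡ 1ℚ →
  (∀ r → 0ℚ ≤ t r) → sumℚ (λ r → μ r * t r) ≡ 0ℚ →
  Σ (Fin l) λ r → t r ≡ 0ℚ
convex-combination≡0⇒zero-term μ t μ≥0 Σμ≡1 t≥0 Σμt≡0
  with sumℚ-pos⇒pos-term μ (subst (0ℚ <_) (sym Σμ≡1) (positive⁻¹ 1ℚ))
... | r , μr>0 = r , *-cancelˡ-≡-pos (μ r) μr>0 (trans μr*tr≡0 (sym (*-zeroʳ (μ r))))
  where
  μr*tr≡0 : μ r * t r ≡ 0ℚ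
  μr*tr≡0 = nonneg-sumℚ≡0 (λ r → μ r * t r) (λ r → *-nonneg (μ≥0 r) (t≥0 r)) Σμt≡0 r

concentrated-row : ∀ {k} (f : Fin k → ℚ) s j →
  (∀ i → 0ℚ ≤ f i) → sumℚ f ≡ s → f j ≡ s → ∀ i → f i ≡ s * δ j i
concentrated-row {k} f s j f≥0 Σf≡s fj≡s i =
  x∙y⁻¹≈ε⇒x≈y (f i) (s * δ j i) (nonneg-sumℚ≡0 excess excess≥0 Σexcess≡0 i)
  where
  excess : Fin k → ℚ
  excess i = f i - s * δ j i

  excess≥0 : ∀ i → 0ℚ ≤ excess i
  excess≥0 i with j ≟ i
  ... | yes refl = ≤-reflexive (sym (begin
    f j - s * δ j j ≡⟨ cong₂ (λ a d → a - s * d) fj≡s (δ-diag j) ⟩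
    s - s * 1ℚ      ≡⟨ cong (λ t → s - t) (*-identityʳ s) ⟩
    s - s           ≡⟨ +-inverseʳ s ⟩
    0ℚ              ∎))
    where open ≡-Reasoning
  ... | no  j≢i = subst (0ℚ ≤_) (sym (begin
    f i - s * δ j i ≡⟨ cong (λ d → f i - s * d) (δ-off j≢i) ⟩
    f i - s * 0ℚ    ≡⟨ cong (λ t → f i - t) (*-zeroʳ s) ⟩
    f i - 0ℚ        ≡⟨ +-identityʳ (f i) ⟩
    f i             ∎)) (f≥0 i)
    where open ≡-Reasoning

  Σexcess≡0 : sumℚ excess ≡ 0ℚ
  Σexcess≡0 = begin
    sumℚ excess                         ≡⟨ sumℚ-- f (λ i → s * δ j i) ⟩
    sumℚ f - sumℚ (λ i → s * δ j i)     ≡⟨ cong₂ _-_ Σf≡s (sym (*-distribˡ-sumℚ s (δ j))) ⟩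
    s - s * sumℚ (δ j)                  ≡⟨ cong (λ t → s - s * t) (sumℚ-δ-row j) ⟩
    s - s * 1ℚ                          ≡⟨ cong (λ t → s - t) (*-identityʳ s) ⟩
    s - s                               ≡⟨ +-inverseʳ s ⟩
    0ℚ                                  ∎
    where open ≡-Reasoning

convex-extreme-row : ∀ {l k} (a : Fin l → Fin k → ℚ) s (μ : Fin l → ℚ) j →
  (∀ r i → 0ℚ ≤ a r i) → (∀ r → sumℚ (a r) ≡ s) →
  (∀ r → 0ℚ ≤ μ r) → sumℚ μ ≡ 1ℚ → sumℚ (λ r → μ r * a r j) ≡ s →
  Σ (Fin l) λ r → ∀ i → a r i ≡ s * δ j i
convex-extreme-row {l} a s μ j a≥0 Σa≡s μ≥0 Σμ≡1 Σμa≡s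
  with convex-combination≡0⇒zero-term μ gap μ≥0 Σμ≡1 gap≥0 Σμgap≡0
  where
  gap : Fin l → ℚ
  gap r = s - a r j
  gap≥0 : ∀ r → 0ℚ ≤ gap r
  gap≥0 r = p≤q⇒0≤q-p (subst (a r j ≤_) (Σa≡s r) (term≤sumℚ (a r) (a≥0 r) j))
  Σμgap≡0 : sumℚ (λ r → μ r * gap r) ≡ 0ℚ
  Σμgap≡0 = begin
    sumℚ (λ r → μ r * (s - a r j))        ≡⟨ sumℚ-weighted-sub μ s (λ r → a r j) ⟩
    sumℚ μ * s - sumℚ (λ r → μ r * a r j) ≡⟨ cong₂ (λ t u → t * s - u) Σμ≡1 Σμa≡s ⟩
    1ℚ * s - s                            ≡⟨ cong (_- s) (*-identityˡ s) ⟩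
    s - s                                 ≡⟨ +-inverseʳ s ⟩
    0ℚ                                    ∎
    where open ≡-Reasoning
... | r , gapr≡0 =
  r , concentrated-row (a r) s j (a≥0 r) (Σa≡s r) (sym (x∙y⁻¹≈ε⇒x≈y s (a r j) gapr≡0))

integral-facet-normal : ∀ {m} (v : Fin (suc m) → Point m) → Reflexive v →
  (∀ c → sumℚ (λ i → v i c) ≡ 0ℚ) →
  (∀ b → sumℚ b ≡ 0ℚ → Σ (Point m) λ x → ∀ i → dot x (v i) ≡ b i) →
  ∀ j → Σ (Fin m → ℤ) λ w → ∀ i → dot (toℚ ∘ w) (v i) ≡ 1ℚ - toℚ (ℤ.+ suc m) * δ j i
integral-facet-normal {m} v (_ , l , w , dual≡conv-w) v-centred v-solvable j =
  w r , λ i → trans (sym (p-[p-q]≡q 1ℚ (dot (W r) (v i)))) (cong (λ t → 1ℚ - t) (slackᵣ≡nδ i))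
  where
  n : ℚ
  n = toℚ (ℤ.+ suc m)

  b : Fin (suc m) → ℚ
  b i = 1ℚ - n * δ j i

  Σb≡0 : sumℚ b ≡ 0ℚ
  Σb≡0 = begin
    sumℚ b
      ≡⟨ sumℚ-- (λ _ → 1ℚ) (λ i → n * δ j i) ⟩
    sumℚ {suc m} (λ _ → 1ℚ) - sumℚ (λ i → n * δ j i)
      ≡⟨ cong₂ _-_ (sumℚ-ones (suc m)) (sym (*-distribˡ-sumℚ n (δ j))) ⟩
    n - n * sumℚ (δ j)
      ≡⟨ cong (λ t → n - n * t) (sumℚ-δ-row j) ⟩
    n - n * 1ℚ
      ≡⟨ cong (λ t → n - t) (*-identityʳ n) ⟩
    n - n
      ≡⟨ +-inverseʳ n ⟩
    0ℚ ∎
    where open ≡-Reasoning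

  x : Point m
  x = proj₁ (v-solvable b Σb≡0)

  x·v≡b : ∀ i → dot x (v i) ≡ b i
  x·v≡b = proj₂ (v-solvable b Σb≡0)

  x∈dual : InDual v x
  x∈dual = InDual-if-vertices v x λ i → begin
    dot x (v i)
      ≡⟨ x·v≡b i ⟩
    1ℚ - n * δ j i
      ≤⟨ +-monoʳ-≤ 1ℚ (neg-antimono-≤ (*-nonneg (<⇒≤ (toℚ-suc>0 m)) (δ-nonneg j i))) ⟩
    1ℚ - 0ℚ
      ≡⟨ +-identityʳ 1ℚ ⟩
    1ℚ ∎
    where open ≤-Reasoning

  W : Fin l → Point m
  W r = toℚ ∘ w r

  x-hull : InConvHull W x
  x-hull = proj₁ (dual≡conv-w x) x∈dual

  μ : Fin l → ℚ
  μ = proj₁ x-hull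

  μ≥0 : ∀ r → 0ℚ ≤ μ r
  μ≥0 = proj₁ (proj₂ x-hull)

  Σμ≡1 : sumℚ μ ≡ 1ℚ
  Σμ≡1 = proj₁ (proj₂ (proj₂ x-hull))

  x≡Σμw : ∀ c → x c ≡ sumℚ (λ r → μ r * W r c)
  x≡Σμw = proj₂ (proj₂ (proj₂ x-hull))

  slack : Fin l → Fin (suc m) → ℚ
  slack r i = 1ℚ - dot (W r) (v i)

  slack≥0 : ∀ r i → 0ℚ ≤ slack r i
  slack≥0 r i =
    p≤q⇒0≤q-p (proj₂ (dual≡conv-w (W r)) (vertex-in-hull W r) (v i) (vertex-in-hull v i))

  Σslack≡n : ∀ r → sumℚ (slack r) ≡ n
  Σslack≡n r = begin
    sumℚ (slack r)
      ≡⟨ sumℚ-- (λ _ → 1ℚ) (λ i → dot (W r) (v i)) ⟩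
    sumℚ {suc m} (λ _ → 1ℚ) - sumℚ (λ i → dot (W r) (v i))
      ≡⟨ cong₂ _-_ (sumℚ-ones (suc m)) (sumℚ-comm (λ i c → W r c * v i c)) ⟩
    n - sumℚ (λ c → sumℚ (λ i → W r c * v i c))
      ≡⟨ cong (λ t → n - t) (sumℚ-cong (λ c → *-distribˡ-sumℚ (W r c) (λ i → v i c))) ⟨
    n - sumℚ (λ c → W r c * sumℚ (λ i → v i c))
      ≡⟨ cong (λ t → n - t) (sumℚ-cong (λ c → trans (cong (W r c *_) (v-centred c)) (*-zeroʳ (W r c)))) ⟩
    n - sumℚ {m} (λ _ → 0ℚ)
      ≡⟨ cong (λ t → n - t) (sumℚ-zero m) ⟩
    n - 0ℚ
      ≡⟨ +-identityʳ n ⟩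
    n ∎
    where open ≡-Reasoning

  Σμslack≡n : sumℚ (λ r → μ r * slack r j) ≡ n
  Σμslack≡n = begin
    sumℚ (λ r → μ r * (1ℚ - dot (W r) (v j)))
      ≡⟨ sumℚ-weighted-sub μ 1ℚ (λ r → dot (W r) (v j)) ⟩
    sumℚ μ * 1ℚ - sumℚ (λ r → μ r * dot (W r) (v j))
      ≡⟨ cong₂ (λ t u → t * 1ℚ - u) Σμ≡1 (sym (dot-combinationˡ x (v j) μ W x≡Σμw)) ⟩
    1ℚ * 1ℚ - dot x (v j)
      ≡⟨ cong (λ t → 1ℚ - t) (trans (x·v≡b j) (cong (λ t → 1ℚ - n * t) (δ-diag j))) ⟩
    1ℚ - (1ℚ - n * 1ℚ)
      ≡⟨ trans (p-[p-q]≡q 1ℚ (n * 1ℚ)) (*-identityʳ n) ⟩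
    n ∎
    where open ≡-Reasoning

  extreme : Σ (Fin l) λ r → ∀ i → slack r i ≡ n * δ j i
  extreme = convex-extreme-row slack n μ j slack≥0 Σslack≡n μ≥0 Σμ≡1 Σμslack≡n

  r : Fin l
  r = proj₁ extreme

  slackᵣ≡nδ : ∀ i → slack r i ≡ n * δ j i
  slackᵣ≡nδ = proj₂ extreme

Λ⇒scaled-integral : ∀ {m} (v : Fin (suc m) → Point m) (s : ℚ) →
  (∀ j → Σ (Fin m → ℤ) λ w → ∀ i → dot (toℚ ∘ w) (v i) ≡ 1ℚ - s * δ j i) →
  ∀ λ' → InLambda v λ' → ∀ j → IsInt (s * λ' j)
Λ⇒scaled-integral {m} v s normal λ' (_ , integral) j =
  subst IsInt Σλ-[Σλ-sλⱼ]≡sλⱼ (IsInt-+ Σλ-integral (IsInt-neg w·K-integral))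
  where
  w : Fin m → ℤ
  w = proj₁ (normal j)

  K : Point m
  K c = sumℚ (λ i → λ' i * v i c)

  K-integral : ∀ c → IsInt (K c)
  K-integral c = subst IsInt (sumℚ-cong (λ i → cong (λ' i *_) (appendLast-inject₁ (v i) 1ℚ c)))
    (integral (inject₁ c))

  Σλ-integral : IsInt (sumℚ λ')
  Σλ-integral = subst IsInt
    (sumℚ-cong (λ i → trans (cong (λ' i *_) (appendLast-last (v i) 1ℚ)) (*-identityʳ (λ' i))))
    (integral (fromℕ m))

  w·K-integral : IsInt (dot (toℚ ∘ w) K)
  w·K-integral = IsInt-sumℚ _ (λ c → IsInt-* (w c , refl) (K-integral c))

  w·K≡Σλ-sλⱼ : dot (toℚ ∘ w) K ≡ sumℚ λ' - s * λ' j
  w·K≡Σλ-sλⱼ = begin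
    dot (toℚ ∘ w) K
      ≡⟨ dot-combinationʳ (toℚ ∘ w) K λ' v (λ c → refl) ⟩
    sumℚ (λ i → λ' i * dot (toℚ ∘ w) (v i))
      ≡⟨ sumℚ-cong (λ i → cong (λ' i *_) (proj₂ (normal j) i)) ⟩
    sumℚ (λ i → λ' i * (1ℚ - s * δ j i))
      ≡⟨ sumℚ-weighted-sub λ' 1ℚ (λ i → s * δ j i) ⟩
    sumℚ λ' * 1ℚ - sumℚ (λ i → λ' i * (s * δ j i))
      ≡⟨ cong₂ _-_ (*-identityʳ (sumℚ λ'))
                   (sumℚ-cong (λ i → x∙yz≈z∙yx (λ' i) s (δ j i))) ⟩
    sumℚ λ' - sumℚ (λ i → δ j i * (s * λ' i))
      ≡⟨ cong (λ t → sumℚ λ' - t) (sumℚ-δ j (λ i → s * λ' i)) ⟩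
    sumℚ λ' - s * λ' j ∎
    where open ≡-Reasoning

  Σλ-[Σλ-sλⱼ]≡sλⱼ : sumℚ λ' + - dot (toℚ ∘ w) K ≡ s * λ' j
  Σλ-[Σλ-sλⱼ]≡sλⱼ =
    trans (cong (λ t → sumℚ λ' - t) w·K≡Σλ-sλⱼ) (p-[p-q]≡q (sumℚ λ') (s * λ' j))

laplacian-sym : ∀ {n} (G : SimpleGraph n) i k → laplacian G i k ≡ laplacian G k i
laplacian-sym G i k with i ≟ k | k ≟ i
... | yes refl | yes _   = refl
... | yes refl | no k≢k  = contradiction refl k≢k
... | no i≢k   | yes k≡i = contradiction (sym k≡i) i≢k
... | no _     | no _    = cong (ℤ.-_ ∘ b2ℤ) (SimpleGraph.sym G i k)

Lℚ : ∀ {n} → SimpleGraph n → Fin n → Fin n → ℚ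
Lℚ G i k = toℚ (laplacian G i k)

Lℚ≡δ*deg-adj : ∀ {n} (G : SimpleGraph n) i k →
  Lℚ G i k ≡ δ i k * toℚ (degree G i) - toℚ (b2ℤ (adj G i k))
Lℚ≡δ*deg-adj G i k with i ≟ k
... | yes refl rewrite irrefl G i | δ-diag i =
  sym (trans (cong (_- 0ℚ) (*-identityˡ (toℚ (degree G i)))) (+-identityʳ _))
... | no  i≢k  rewrite δ-off i≢k =
  trans (toℚ-neg (b2ℤ (adj G i k)))
    (sym (trans (cong (_- toℚ (b2ℤ (adj G i k))) (*-zeroˡ (toℚ (degree G i)))) (+-identityˡ _)))

Lℚ-rowsum : ∀ {n} (G : SimpleGraph n) i → sumℚ (Lℚ G i) ≡ 0ℚ
Lℚ-rowsum {n} G i = begin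
  sumℚ (Lℚ G i)                                 ≡⟨ sumℚ-cong (Lℚ≡δ*deg-adj G i) ⟩
  sumℚ (λ k → δ i k * d - A k)                  ≡⟨ sumℚ-- (λ k → δ i k * d) A ⟩
  sumℚ (λ k → δ i k * d) - sumℚ A               ≡⟨ cong (_- sumℚ A) (sumℚ-δ i (λ _ → d)) ⟩
  d - sumℚ A                                    ≡⟨ cong (_- sumℚ A) (toℚ-sumℤ (b2ℤ ∘ adj G i)) ⟩
  sumℚ A - sumℚ A                               ≡⟨ +-inverseʳ (sumℚ A) ⟩
  0ℚ                                            ∎
  where
  open ≡-Reasoning
  d : ℚ
  d = toℚ (degree G i)
  A : Fin n → ℚ
  A k = toℚ (b2ℤ (adj G i k))

laplacian-facet-normal : ∀ {m} (G : SimpleGraph (suc m)) → Reflexive (lapVertices G) →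
  ∀ j → Σ (Fin m → ℤ) λ w →
    ∀ i → dot (toℚ ∘ w) (lapVertices G i) ≡ 1ℚ - toℚ (ℤ.+ suc m) * δ j i
laplacian-facet-normal G v-reflexive@(v-interior , _) =
  integral-facet-normal (lapVertices G) v-reflexive centred
    (solvable (interior⇒unit-in-span (lapVertices G) v-interior))
  where
  Lℚ-sym : ∀ i k → Lℚ G i k ≡ Lℚ G k i
  Lℚ-sym i k = cong toℚ (laplacian-sym G i k)
  open SymmetricZeroRowSum (Lℚ G) Lℚ-sym (Lℚ-rowsum G)
  centred : ∀ c → sumℚ (λ i → lapVertices G i c) ≡ 0ℚ
  centred c = trans (sumℚ-cong (λ i → Lℚ-sym i (inject₁ c))) (Lℚ-rowsum G (inject₁ c))

module Scaled (m : ℕ) (x : ℤ) (q : ℚ) (x≡n*q : toℚ x ≡ toℚ (ℤ.+ suc m) * q) where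

  private
    n : ℚ
    n = toℚ (ℤ.+ suc m)
    n>0 : 0ℚ < n
    n>0 = toℚ-suc>0 m

  ≡/ : q ≡ x / suc m
  ≡/ = *-cancelˡ-≡-pos n n>0 (trans (sym x≡n*q) (sym (n*[z/n]≡z x m)))

  0≤q<1⇒0≤x<n : (0ℚ ≤ q) × (q < 1ℚ) → (ℤ.+ 0 ℤ.≤ x) × (x ℤ.< ℤ.+ suc m)
  0≤q<1⇒0≤x<n (q≥0 , q<1) =
    toℚ-cancel-≤ {ℤ.+ 0} (subst (0ℚ ≤_) (sym x≡n*q) (*-nonneg (<⇒≤ n>0) q≥0)) ,
    toℚ-cancel-< (subst₂ _<_ (sym x≡n*q) (*-identityʳ n) (*-monoʳ-<-pos n {{positive n>0}} q<1))

  0≤x<n⇒0≤q<1 : (ℤ.+ 0 ℤ.≤ x) × (x ℤ.< ℤ.+ suc m) → (0ℚ ≤ q) × (q < 1ℚ)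
  0≤x<n⇒0≤q<1 (x≥0 , x<n) =
    *-cancelˡ-≤-pos n {{positive n>0}} (subst₂ _≤_ (sym (*-zeroʳ n)) x≡n*q (toℚ-mono-≤ x≥0)) ,
    *-cancelˡ-<-nonNeg n {{nonNegative (<⇒≤ n>0)}}
      (subst₂ _<_ x≡n*q (sym (*-identityʳ n)) (toℚ-mono-< x<n))

  IsInt⇒∣ : IsInt q → ℤ.+ suc m ∣ᵤ x
  IsInt⇒∣ (k , refl) = ∣⇒∣ᵤ {ℤ.+ suc m} {x} (divides k (toℚ-injective (trans x≡n*q
    (trans (sym (toℚ-* (ℤ.+ suc m) k)) (cong toℚ (ℤ.*-comm (ℤ.+ suc m) k))))))

  ∣⇒IsInt : ℤ.+ suc m ∣ᵤ x → IsInt q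
  ∣⇒IsInt n∣x with ∣ᵤ⇒∣ {ℤ.+ suc m} {x} n∣x
  ... | divides k x≡k*n = k , *-cancelˡ-≡-pos n n>0
    (trans (sym x≡n*q) (trans (cong toℚ x≡k*n) (trans (toℚ-* k (ℤ.+ suc m)) (*-comm (toℚ k) n))))

module ScaledLaplacianCoordinates {m} (G : SimpleGraph (suc m)) (λ' : Point (suc m))
  (x : Fin (suc m) → ℤ) (x≡n*λ : ∀ i → toℚ (x i) ≡ toℚ (ℤ.+ suc m) * λ' i) where

  x·aug≡n*λ·aug : ∀ c → toℚ (sumℤ (λ i → x i ℤ.* laplacianAug G i c))
    ≡ toℚ (ℤ.+ suc m) * sumℚ (λ i → λ' i * appendLast (lapVertices G i) 1ℚ c)
  x·aug≡n*λ·aug c =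
    trans (toℚ-sumℤ-scaled (toℚ (ℤ.+ suc m)) x (λ i → laplacianAug G i c) λ' x≡n*λ)
    (cong (toℚ (ℤ.+ suc m) *_)
      (sumℚ-cong (λ i → cong (λ' i *_) (appendLast-map toℚ (laplacianDel G i) (ℤ.+ 1) c))))

  module Entry i = Scaled m (x i) (λ' i) (x≡n*λ i)
  module Column c = Scaled m (sumℤ (λ i → x i ℤ.* laplacianAug G i c))
    (sumℚ (λ i → λ' i * appendLast (lapVertices G i) 1ℚ c)) (x·aug≡n*λ·aug c)

theorem3p11 : (m : ℕ) (G : SimpleGraph (suc m)) →
    Connected G → Reflexive (lapVertices G) →
    (λ' : Point (suc m)) →
      (InLambda (lapVertices G) λ' → InRHS G λ') × (InRHS G λ' → InLambda (lapVertices G) λ')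
theorem3p11 m G _ v-reflexive λ' = Λ⊆RHS , RHS⊆Λ
  where
  Λ⊆RHS : InLambda (lapVertices G) λ' → InRHS G λ'
  Λ⊆RHS λ∈Λ@(λ-bounds , λ-integral) =
    x , (λ i → Entry.0≤q<1⇒0≤x<n i (λ-bounds i)) ,
        (λ c → Column.IsInt⇒∣ c (λ-integral c)) , Entry.≡/
    where
    n*λ-integral : ∀ i → IsInt (toℚ (ℤ.+ suc m) * λ' i)
    n*λ-integral = Λ⇒scaled-integral (lapVertices G) (toℚ (ℤ.+ suc m))
                     (laplacian-facet-normal G v-reflexive) λ' λ∈Λ
    x : Fin (suc m) → ℤ
    x i = proj₁ (n*λ-integral i)
    open ScaledLaplacianCoordinates G λ' x (λ i → sym (proj₂ (n*λ-integral i)))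

  RHS⊆Λ : InRHS G λ' → InLambda (lapVertices G) λ'
  RHS⊆Λ (x , x-bounds , n∣x·aug , λ≡x/n) =
    (λ i → Entry.0≤x<n⇒0≤q<1 i (x-bounds i)) , (λ c → Column.∣⇒IsInt c (n∣x·aug c))
    where
    open ScaledLaplacianCoordinates G λ' x
      (λ i → trans (sym (n*[z/n]≡z (x i) m)) (cong (toℚ (ℤ.+ suc m) *_) (sym (λ≡x/n i))))
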